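{- Let $G$ be a group and $H \leq A \leq L\leq G$. If $A$ is a perfect code of $(G,H)$, then $A$ is a perfect code of $(L,H)$.
   Context: All groups are finite. For a group $G$, a subgroup $H\leq G$ and a subset $U\subseteq G$ which is a union of double cosets of $H$ with $H\cap U=\emptyset$ and $U^{ -1}=U$, the coset graph $\mathrm{Cos}(G,H,U)$ has as vertex set the set of left cosets of $H$ in $G$, with $g_1H$ and $g_2H$ adjacent iff $g_1^{ -1}g_2\in U$. A perfect code in a graph is an independent set $C$ of vertices such that every vertex outside $C$ is adjacent to exactly one vertex of $C$. For $H\leq A\leq G$, $A$ is called a perfect code of the pair $(G,H)$ if there is a coset graph $\mathrm{Cos}(G,H,U)$ in which the set $\{aH: a\in A\}$ of left cosets of $H$ contained in $A$ is a perfect code. -}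

module Defs where

open import Level using (Level; _⊔_; suc)
open import Algebra.Bundles using (Group)
open import Data.Nat using (ℕ)
open import Data.Fin using (Fin)
open import Data.Product using (Σ; ∃; _×_; _,_)
open import Relation.Nullary using (¬_)

module _ {c ℓ : Level} (G : Group c ℓ) where
  open Group G

  IsFinite : Set (c ⊔ ℓ)
  IsFinite = Σ ℕ λ n → Σ (Fin n → Carrier) λ f → ∀ x → ∃ λ i → f i ≈ x

  Respects≈ : {p : Level} → (Carrier → Set p) → Set (c ⊔ ℓ ⊔ p)
  Respects≈ P = ∀ {x y} → x ≈ y → P x → P y

  _⊆_ : {p q : Level} → (Carrier → Set p) → (Carrier → Set q) → Set (c ⊔ p ⊔ q)
  P ⊆ Q = ∀ {x} → P x → Q x

  record IsSubgroup {p : Level} (P : Carrier → Set p) : Set (c ⊔ ℓ ⊔ p) where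
    field
      resp  : Respects≈ P
      has-ε : P ε
      ∙-closed : ∀ {x y} → P x → P y → P (x ∙ y)
      ⁻¹-closed : ∀ {x} → P x → P (x ⁻¹)

  -- Coset graph Cos(K, H, U), where K is a subgroup of G (the ambient group
  -- of the pair (K,H)); vertices are left cosets gH (g ∈ K), represented by
  -- elements g of K, with gH = g'H iff g⁻¹g' ∈ H.
  record IsConnectionSet {p : Level} (K H U : Carrier → Set p) : Set (c ⊔ ℓ ⊔ p) where
    field
      resp       : Respects≈ U
      ⊆K         : U ⊆ K
      double     : ∀ {h u h'} → H h → U u → H h' → U ((h ∙ u) ∙ h')
      disjoint   : ∀ {x} → H x → ¬ U x
      inv-closed : ∀ {u} → U u → U (u ⁻¹)

  SameCoset : {p : Level} → (Carrier → Set p) → Carrier → Carrier → Set p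
  SameCoset H g g' = H (g ⁻¹ ∙ g')

  Adj : {p : Level} → (Carrier → Set p) → Carrier → Carrier → Set p
  Adj U g g' = U (g ⁻¹ ∙ g')

  record IsPerfectCodeIn {p : Level} (K H U A : Carrier → Set p) : Set (c ⊔ ℓ ⊔ p) where
    field
      independent : ∀ {a a'} → A a → A a' → ¬ Adj U a a'
      covers : ∀ {g} → K g → ¬ (∃ λ a → A a × SameCoset H a g) →
               ∃ λ a → A a × Adj U g a
      unique : ∀ {g} → K g → ¬ (∃ λ a → A a × SameCoset H a g) →
               ∀ {a a'} → A a → Adj U g a → A a' → Adj U g a' → SameCoset H a a'

  IsPerfectCodeOfPair : {p : Level} → (K H A : Carrier → Set p) → Set (c ⊔ ℓ ⊔ suc p)
  IsPerfectCodeOfPair {p} K H A =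
    Σ (Carrier → Set p) λ U → IsConnectionSet K H U × IsPerfectCodeIn K H U A

  Whole : {p : Level} → Carrier → Set p
  Whole _ = Level.Lift _ Data.Unit.⊤
    where import Data.Unit

-- Intersecting a connection set U of Cos(G, H, U) with L gives a connection
-- set of Cos(L, H, U ∩ L): the axioms of U survive because H ⊆ L and L is a
-- subgroup.  The vertices of Cos(L, H, U ∩ L) are among those of Cos(G, H, U),
-- and two of them, gH and aH with g, a ∈ L, are adjacent in one graph exactly
-- when they are adjacent in the other, since then g⁻¹a ∈ L.  So the
-- independence, covering and uniqueness properties of the code {aH : a ∈ A}
-- restrict from the larger graph to the smaller one.
module Submission where

open import Defs
open import Level using (Level)
open import Algebra.Bundles using (Group)
open import Data.Product using (_×_; _,_; proj₂)

module _ {c ℓ : Level} (G : Group c ℓ) where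
  open Group G

  _∩_ : {p : Level} → (Carrier → Set p) → (Carrier → Set p) → Carrier → Set p
  (U ∩ K) x = U x × K x

  module _ {p : Level} {K K′ H U : Carrier → Set p}
           (K-subgroup : IsSubgroup G K) (H⊆K : _⊆_ G H K) where
    open IsSubgroup K-subgroup

    restrict-isConnectionSet : IsConnectionSet G K′ H U → IsConnectionSet G K H (U ∩ K)
    restrict-isConnectionSet U-conn = record
      { resp       = λ x≈y (u , k) → U.resp x≈y u , resp x≈y k
      ; ⊆K         = proj₂
      ; double     = λ h (u , k) h′ → U.double h u h′ , ∙-closed (∙-closed (H⊆K h) k) (H⊆K h′)
      ; disjoint   = λ h (u , _) → U.disjoint h u
      ; inv-closed = λ (u , k) → U.inv-closed u , ⁻¹-closed k
      }
      where module U = IsConnectionSet U-conn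

    restrict-isPerfectCodeIn : {A : Carrier → Set p} → _⊆_ G K K′ → _⊆_ G A K →
                               IsPerfectCodeIn G K′ H U A → IsPerfectCodeIn G K H (U ∩ K) A
    restrict-isPerfectCodeIn K⊆K′ A⊆K A-code = record
      { independent = λ a a′ (u , _) → C.independent a a′ u
      ; covers      = λ g∈K g∉A →
          let (a , a∈A , u) = C.covers (K⊆K′ g∈K) g∉A
          in  a , a∈A , u , ∙-closed (⁻¹-closed g∈K) (A⊆K a∈A)
      ; unique      = λ g∈K g∉A a∈A (u , _) a′∈A (u′ , _) →
          C.unique (K⊆K′ g∈K) g∉A a∈A u a′∈A u′
      }
      where module C = IsPerfectCodeIn A-code

  restrict-isPerfectCodeOfPair : {p : Level} {K K′ H A : Carrier → Set p} →
    IsSubgroup G K → _⊆_ G K K′ → _⊆_ G H A → _⊆_ G A K →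
    IsPerfectCodeOfPair G K′ H A → IsPerfectCodeOfPair G K H A
  restrict-isPerfectCodeOfPair {K = K} K-subgroup K⊆K′ H⊆A A⊆K (U , U-conn , A-code) =
    (U ∩ K) ,
    restrict-isConnectionSet K-subgroup (λ h → A⊆K (H⊆A h)) U-conn ,
    restrict-isPerfectCodeIn K-subgroup (λ h → A⊆K (H⊆A h)) K⊆K′ A⊆K A-code

corollary3p5 : {c ℓ p : Level} (G : Group c ℓ) → IsFinite G →
    (H A L : Group.Carrier G → Set p) →
    IsSubgroup G H → IsSubgroup G A → IsSubgroup G L →
    _⊆_ G H A → _⊆_ G A L →
    IsPerfectCodeOfPair G (Whole G) H A →
    IsPerfectCodeOfPair G L H A
corollary3p5 G _ H A L _ _ L-subgroup H⊆A A⊆L =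
  restrict-isPerfectCodeOfPair G L-subgroup (λ _ → _) H⊆A A⊆L
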